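{- For all integers $a,b\geq 0$ there exists an $SMR(4b+2,(4a+3)(2b+1);4a+3,2)$.
   Context: A signed magic rectangle $SMR(m,n;r,s)$ is an $m\times n$ array, some of whose cells are filled with integers and the others empty, such that exactly $r$ cells in every row and exactly $s$ cells in every column are filled (so $mr=ns$), every element of $X$ appears exactly once in the array, and the sum of the entries of each row and of each column is zero, where (for $mr$ even) $X=\{\pm1,\pm2,\ldots,\pm mr/2\}$. -}

module Defs where

open import Data.Nat as ℕ using (ℕ; zero; suc; _≤_)
open import Data.Integer as ℤ using (ℤ; +_; -_; ∣_∣)
open import Data.Fin using (Fin)
open import Data.Maybe using (Maybe; just; nothing)
open import Data.Product using (Σ; _×_; _,_; ∃-syntax)
open import Relation.Binary.PropositionalEquality using (_≡_)
open import Relation.Nullary using (¬_)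

-- A partially filled m × n array of integers: nothing = empty cell.
PArray : ℕ → ℕ → Set
PArray m n = Fin m → Fin n → Maybe ℤ

sumℕ : ∀ {n} → (Fin n → ℕ) → ℕ
sumℕ {zero}  f = 0
sumℕ {suc n} f = f Data.Fin.zero ℕ.+ sumℕ (λ i → f (Data.Fin.suc i))

sumℤ : ∀ {n} → (Fin n → ℤ) → ℤ
sumℤ {zero}  f = + 0
sumℤ {suc n} f = f Data.Fin.zero ℤ.+ sumℤ (λ i → f (Data.Fin.suc i))

filled : Maybe ℤ → ℕ
filled (just _) = 1
filled nothing  = 0

val : Maybe ℤ → ℤ
val (just x) = x
val nothing  = + 0

InX : ℕ → ℤ → Set
InX k x = (1 ≤ ∣ x ∣) × (∣ x ∣ ≤ k)

-- Signed magic rectangle SMR(m,n;r,s) (for m·r even), with X = {±1,…,±(m·r/2)};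
-- here k stands for m·r/2, required to satisfy 2·k = m·r.
record IsSMR (m n r s : ℕ) (A : PArray m n) : Set where
  field
    rowCount : ∀ i → sumℕ (λ j → filled (A i j)) ≡ r
    colCount : ∀ j → sumℕ (λ i → filled (A i j)) ≡ s
    entriesInX : ∀ i j x → A i j ≡ just x → InX ((m ℕ.* r) ℕ./ 2) x
    eachOnce : ∀ x → InX ((m ℕ.* r) ℕ./ 2) x →
               Σ (Fin m × Fin n) λ { (i , j) → (A i j ≡ just x) ×
                 (∀ i' j' → A i' j' ≡ just x → (i' ≡ i) × (j' ≡ j)) }
    rowSum : ∀ i → sumℤ (λ j → val (A i j)) ≡ + 0
    colSum : ∀ j → sumℤ (λ i → val (A i j)) ≡ + 0

SMR : ℕ → ℕ → ℕ → ℕ → Set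
SMR m n r s = Σ (PArray m n) (IsSMR m n r s)

-- Column j of the array holds +(j+1) and −(j+1) in two distinct rows, so the column conditions
-- and the requirement that every element of X occurs once hold by construction; it remains to
-- choose the two rows of every column so that each row receives 4a+3 cells whose positive and
-- negative entries have equal sums. With c = 2b+1 and rows s and c+s (s < c), the first 3c
-- columns give row s the entries s+1, c+s+1, −(c+2s+2) and row c+s the entries 2c+s+1, −(c−s),
-- −(c+2s+1). Every further group of 4c columns starting at column o gives row s the entries
-- x, −(x+c), −(x+2c), x+3c with x = o+s+1, and row c+s their negatives. Nothing here uses that
-- c is odd, so the array exists with 2c rows for every c.
module Submission where

open import Defs
open import Data.Nat using (ℕ; _+_; _*_)
open import Data.Nat.Base using (zero; suc; _∸_; _<_; _≤_; z≤n; s≤s)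
open import Data.Nat.Properties
open import Data.Nat.DivMod using (_/_; m*n/n≡m)
open import Data.Integer as ℤ using (ℤ; -[1+_]) renaming (+_ to pos)
import Data.Integer.Properties as ℤ
import Data.Integer.Tactic.RingSolver as ℤ-Solver
open import Data.Fin as Fin using (Fin; toℕ; fromℕ<)
open import Data.Fin.Properties using (toℕ<n; toℕ-fromℕ<; toℕ-injective)
open import Data.Maybe using (Maybe; just; nothing)
open import Data.Product using (Σ; _×_; _,_; proj₁; proj₂)
open import Data.Empty using (⊥-elim)
open import Function using (_∘_; const)
open import Relation.Nullary using (Dec; yes; no; ¬_)
open import Relation.Binary.PropositionalEquality
open import Data.Nat.Tactic.RingSolver using (solve-∀)
open import Algebra.Properties.CommutativeSemigroup +-commutativeSemigroup using (interchange)

∑ : ℕ → (ℕ → ℕ) → ℕ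
∑ zero    f = 0
∑ (suc n) f = f 0 + ∑ n (f ∘ suc)

sumℕ≡∑ : ∀ n {h : Fin n → ℕ} (f : ℕ → ℕ) → (∀ j → h j ≡ f (toℕ j)) → sumℕ h ≡ ∑ n f
sumℕ≡∑ zero    f h≗f = refl
sumℕ≡∑ (suc n) f h≗f = cong₂ _+_ (h≗f Fin.zero) (sumℕ≡∑ n (f ∘ suc) (h≗f ∘ Fin.suc))

sumℤ≡∑-∑ : ∀ n {h : Fin n → ℤ} (f g : ℕ → ℕ) → (∀ j → h j ≡ pos (f (toℕ j)) ℤ.- pos (g (toℕ j))) →
           sumℤ h ≡ pos (∑ n f) ℤ.- pos (∑ n g)
sumℤ≡∑-∑ zero    f g h≗f-g = refl
sumℤ≡∑-∑ (suc n) {h} f g h≗f-g = begin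
  h Fin.zero ℤ.+ sumℤ (h ∘ Fin.suc)
    ≡⟨ cong₂ ℤ._+_ (h≗f-g Fin.zero) (sumℤ≡∑-∑ n (f ∘ suc) (g ∘ suc) (h≗f-g ∘ Fin.suc)) ⟩
  (pos (f 0) ℤ.- pos (g 0)) ℤ.+ (pos (∑ n (f ∘ suc)) ℤ.- pos (∑ n (g ∘ suc)))
    ≡⟨ regroup (pos (f 0)) (pos (g 0)) (pos (∑ n (f ∘ suc))) (pos (∑ n (g ∘ suc))) ⟩
  (pos (f 0) ℤ.+ pos (∑ n (f ∘ suc))) ℤ.- (pos (g 0) ℤ.+ pos (∑ n (g ∘ suc)))
    ≡⟨ sym (cong₂ ℤ._-_ (ℤ.pos-+ (f 0) _) (ℤ.pos-+ (g 0) _)) ⟩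
  pos (∑ (suc n) f) ℤ.- pos (∑ (suc n) g) ∎
  where
  open ≡-Reasoning
  regroup : ∀ x y z w → (x ℤ.- y) ℤ.+ (z ℤ.- w) ≡ (x ℤ.+ z) ℤ.- (y ℤ.+ w)
  regroup = ℤ-Solver.solve-∀

∑-cong : ∀ n {f g : ℕ → ℕ} → (∀ i → i < n → f i ≡ g i) → ∑ n f ≡ ∑ n g
∑-cong zero    f≗g = refl
∑-cong (suc n) f≗g = cong₂ _+_ (f≗g 0 (s≤s z≤n)) (∑-cong n (λ i i<n → f≗g (suc i) (s≤s i<n)))

∑-split : ∀ m n (f : ℕ → ℕ) → ∑ (m + n) f ≡ ∑ m f + ∑ n (f ∘ (m +_))
∑-split zero    n f = refl
∑-split (suc m) n f = trans (cong (f 0 +_) (∑-split m n (f ∘ suc))) (sym (+-assoc (f 0) _ _))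

∑-distrib-+ : ∀ n (f g : ℕ → ℕ) → ∑ n (λ i → f i + g i) ≡ ∑ n f + ∑ n g
∑-distrib-+ zero    f g = refl
∑-distrib-+ (suc n) f g =
  trans (cong ((f 0 + g 0) +_) (∑-distrib-+ n (f ∘ suc) (g ∘ suc)))
        (interchange (f 0) (g 0) (∑ n (f ∘ suc)) (∑ n (g ∘ suc)))

∑-zero : ∀ n {f : ℕ → ℕ} → (∀ i → i < n → f i ≡ 0) → ∑ n f ≡ 0
∑-zero zero    f≗0 = refl
∑-zero (suc n) f≗0 = cong₂ _+_ (f≗0 0 (s≤s z≤n)) (∑-zero n (λ i i<n → f≗0 (suc i) (s≤s i<n)))

∑-single : ∀ n {f : ℕ → ℕ} {i₀} → i₀ < n → (∀ i → i < n → i ≢ i₀ → f i ≡ 0) → ∑ n f ≡ f i₀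
∑-single (suc n) {f} {zero} _ f≗0 =
  trans (cong (f 0 +_) (∑-zero n (λ i i<n → f≗0 (suc i) (s≤s i<n) λ ()))) (+-identityʳ (f 0))
∑-single (suc n) {f} {suc i₀} (s≤s i₀<n) f≗0 =
  cong₂ _+_ (f≗0 0 (s≤s z≤n) λ ())
            (∑-single n i₀<n (λ i i<n i≢i₀ → f≗0 (suc i) (s≤s i<n) (i≢i₀ ∘ suc-injective)))

select : {A : Set} → Dec A → ℕ → ℕ
select (yes _) x = x
select (no _)  x = 0

select-yes : {A : Set} (a? : Dec A) → A → ∀ x → select a? x ≡ x
select-yes (yes _) a x = refl
select-yes (no ¬a) a x = ⊥-elim (¬a a)

select-no : {A : Set} (a? : Dec A) → ¬ A → ∀ x → select a? x ≡ 0
select-no (yes a) ¬a x = ⊥-elim (¬a a)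
select-no (no _)  ¬a x = refl

module _ {P : ℕ → Set} (P? : ∀ i → Dec (P i)) (w : ℕ → ℕ) where

  ∑-select-none : ∀ n → (∀ i → i < n → ¬ P i) → ∑ n (λ i → select (P? i) (w i)) ≡ 0
  ∑-select-none n ¬P = ∑-zero n (λ i i<n → select-no (P? i) (¬P i i<n) (w i))

  ∑-select-unique : ∀ n {i₀} → i₀ < n → P i₀ → (∀ i → i < n → P i → i ≡ i₀) →
                    ∑ n (λ i → select (P? i) (w i)) ≡ w i₀
  ∑-select-unique n {i₀} i₀<n Pi₀ unique =
    trans (∑-single n i₀<n (λ i i<n i≢i₀ → select-no (P? i) (i≢i₀ ∘ unique i i<n) (w i)))
          (select-yes (P? i₀) Pi₀ (w i₀))

∑-select-point : ∀ m {p} x → p < m → ∑ m (λ i → select (p ≟ i) x) ≡ x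
∑-select-point m {p} x p<m = ∑-select-unique (p ≟_) (const x) m p<m refl (λ _ _ → sym)

-- The rows of the two cells of a column j, which hold +(j+1) and −(j+1) respectively.
Column : Set
Column = ℕ × ℕ

ValidColumn : ℕ → Column → Set
ValidColumn m p = proj₁ p < m × proj₂ p < m × proj₁ p ≢ proj₂ p

-- o is the global index of the first of the n columns.
weight : (ℕ → ℕ) → ℕ → ℕ → ℕ → (ℕ → ℕ) → ℕ
weight row o n i x = ∑ n (λ t → select (row t ≟ i) (x (o + t)))

occupancy : (ℕ → Column) → ℕ → ℕ → ℕ
occupancy col n i = weight (proj₁ ∘ col) 0 n i (const 1) + weight (proj₂ ∘ col) 0 n i (const 1)

Balanced : (ℕ → Column) → ℕ → ℕ → ℕ → Set
Balanced col o n i = weight (proj₁ ∘ col) o n i suc ≡ weight (proj₂ ∘ col) o n i suc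

record IsPairing (m n r : ℕ) (col : ℕ → Column) : Set where
  field
    valid    : ∀ j → j < n → ValidColumn m (col j)
    count    : ∀ i → i < m → occupancy col n i ≡ r
    balanced : ∀ i → i < m → Balanced col 0 n i

entry : {A B : Set} → Dec A → Dec B → ℕ → Maybe ℤ
entry (yes _) _       j = just (pos (suc j))
entry (no _)  (yes _) j = just -[1+ j ]
entry (no _)  (no _)  j = nothing

module _ {A B : Set} where

  filled-entry : ∀ (a? : Dec A) (b? : Dec B) j → ¬ (A × B) →
    filled (entry a? b? j) ≡ select a? 1 + select b? 1
  filled-entry (yes a) (yes b) j ¬a×b = ⊥-elim (¬a×b (a , b))
  filled-entry (yes _) (no _)  j ¬a×b = refl
  filled-entry (no _)  (yes _) j ¬a×b = refl
  filled-entry (no _)  (no _)  j ¬a×b = refl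

  val-entry : ∀ (a? : Dec A) (b? : Dec B) j → ¬ (A × B) →
    val (entry a? b? j) ≡ pos (select a? (suc j)) ℤ.- pos (select b? (suc j))
  val-entry (yes a) (yes b) j ¬a×b = ⊥-elim (¬a×b (a , b))
  val-entry (yes _) (no _)  j ¬a×b = cong pos (sym (+-identityʳ (suc j)))
  val-entry (no _)  (yes _) j ¬a×b = refl
  val-entry (no _)  (no _)  j ¬a×b = refl

  ∣entry∣ : ∀ (a? : Dec A) (b? : Dec B) j {x} → entry a? b? j ≡ just x → ℤ.∣ x ∣ ≡ suc j
  ∣entry∣ (yes _) _       j refl = refl
  ∣entry∣ (no _)  (yes _) j refl = refl

  entry-pos⁻¹ : ∀ (a? : Dec A) (b? : Dec B) j {v} → entry a? b? j ≡ just (pos (suc v)) → A × j ≡ v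
  entry-pos⁻¹ (yes a) _       j refl = a , refl
  entry-pos⁻¹ (no _)  (yes _) j ()

  entry-neg⁻¹ : ∀ (a? : Dec A) (b? : Dec B) j {v} → entry a? b? j ≡ just -[1+ v ] → B × j ≡ v
  entry-neg⁻¹ (no _) (yes b) j refl = b , refl
  entry-neg⁻¹ (yes _) _      j ()

  entry-pos : ∀ (a? : Dec A) (b? : Dec B) j → A → entry a? b? j ≡ just (pos (suc j))
  entry-pos (yes _) _ j a = refl
  entry-pos (no ¬a) _ j a = ⊥-elim (¬a a)

  entry-neg : ∀ (a? : Dec A) (b? : Dec B) j → ¬ A → B → entry a? b? j ≡ just -[1+ j ]
  entry-neg (yes a) _       j ¬a b = ⊥-elim (¬a a)
  entry-neg (no _)  (yes _) j ¬a b = refl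
  entry-neg (no _)  (no ¬b) j ¬a b = ⊥-elim (¬b b)

module _ {m n r : ℕ} {col : ℕ → Column} (mr≡2n : m * r ≡ n * 2) (pairing : IsPairing m n r col) where
  open IsPairing pairing

  array : PArray m n
  array i j = entry (proj₁ (col (toℕ j)) ≟ toℕ i) (proj₂ (col (toℕ j)) ≟ toℕ i) (toℕ j)

  top≢bot : ∀ j i → j < n → ¬ (proj₁ (col j) ≡ i × proj₂ (col j) ≡ i)
  top≢bot j i j<n (t≡i , b≡i) = proj₂ (proj₂ (valid j j<n)) (trans t≡i (sym b≡i))

  half-mr≡n : (m * r) / 2 ≡ n
  half-mr≡n = trans (cong (_/ 2) mr≡2n) (m*n/n≡m n 2)

  array-fromℕ< : ∀ {i j} (i<m : i < m) (j<n : j < n) →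
                 array (fromℕ< i<m) (fromℕ< j<n) ≡ entry (proj₁ (col j) ≟ i) (proj₂ (col j) ≟ i) j
  array-fromℕ< i<m j<n = cong₂ (λ i j → entry (proj₁ (col j) ≟ i) (proj₂ (col j) ≟ i) j)
                                (toℕ-fromℕ< i<m) (toℕ-fromℕ< j<n)

  OccursOnce : ℤ → Set
  OccursOnce y = Σ (Fin m × Fin n) λ { (i , j) →
    (array i j ≡ just y) × (∀ i' j' → array i' j' ≡ just y → (i' ≡ i) × (j' ≡ j)) }

  uniqueOccurrence : ∀ {y} v (v<n : v < n) (ρ : Column → ℕ) (ρ<m : ρ (col v) < m) →
    array (fromℕ< ρ<m) (fromℕ< v<n) ≡ just y →
    (∀ i j → array i j ≡ just y → ρ (col (toℕ j)) ≡ toℕ i × toℕ j ≡ v) →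
    OccursOnce y
  uniqueOccurrence v v<n ρ ρ<m here onlyHere = (fromℕ< ρ<m , fromℕ< v<n) , here , λ i j eq →
    let (ρ≡i , j≡v) = onlyHere i j eq in
    toℕ-injective (trans (sym ρ≡i) (trans (cong (ρ ∘ col) j≡v) (sym (toℕ-fromℕ< ρ<m)))) ,
    toℕ-injective (trans j≡v (sym (toℕ-fromℕ< v<n)))

  eachOnce : ∀ x → InX ((m * r) / 2) x → OccursOnce x
  eachOnce (pos zero) (() , _)
  eachOnce (pos (suc v)) (_ , v<k) =
    let v<n = subst (suc v ≤_) half-mr≡n v<k ; (t<m , _ , _) = valid v v<n in
    uniqueOccurrence v v<n proj₁ t<m (trans (array-fromℕ< t<m v<n) (entry-pos _ _ v refl))
               (λ i j → entry-pos⁻¹ _ _ _)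
  eachOnce -[1+ v ] (_ , v<k) =
    let v<n = subst (suc v ≤_) half-mr≡n v<k ; (_ , b<m , t≢b) = valid v v<n in
    uniqueOccurrence v v<n proj₂ b<m (trans (array-fromℕ< b<m v<n) (entry-neg _ _ v t≢b refl))
               (λ i j → entry-neg⁻¹ _ _ _)

  rowCount : ∀ i → sumℕ (λ j → filled (array i j)) ≡ r
  rowCount i = begin
    sumℕ (λ j → filled (array i j))
      ≡⟨ sumℕ≡∑ n (λ j → select (proj₁ (col j) ≟ toℕ i) 1 + select (proj₂ (col j) ≟ toℕ i) 1)
           (λ j → filled-entry (proj₁ (col (toℕ j)) ≟ toℕ i) (proj₂ (col (toℕ j)) ≟ toℕ i) (toℕ j)
                               (top≢bot (toℕ j) (toℕ i) (toℕ<n j))) ⟩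
    ∑ n (λ j → select (proj₁ (col j) ≟ toℕ i) 1 + select (proj₂ (col j) ≟ toℕ i) 1)
      ≡⟨ ∑-distrib-+ n _ _ ⟩
    weight (proj₁ ∘ col) 0 n (toℕ i) (const 1) + weight (proj₂ ∘ col) 0 n (toℕ i) (const 1)
      ≡⟨ count (toℕ i) (toℕ<n i) ⟩
    r ∎
    where open ≡-Reasoning

  colCount : ∀ j → sumℕ (λ i → filled (array i j)) ≡ 2
  colCount j = begin
    sumℕ (λ i → filled (array i j))
      ≡⟨ sumℕ≡∑ m (λ i → select (proj₁ (col v) ≟ i) 1 + select (proj₂ (col v) ≟ i) 1)
           (λ i → filled-entry (proj₁ (col v) ≟ toℕ i) (proj₂ (col v) ≟ toℕ i) v
                               (top≢bot v (toℕ i) (toℕ<n j))) ⟩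
    ∑ m (λ i → select (proj₁ (col v) ≟ i) 1 + select (proj₂ (col v) ≟ i) 1)
      ≡⟨ ∑-distrib-+ m _ _ ⟩
    ∑ m (λ i → select (proj₁ (col v) ≟ i) 1) + ∑ m (λ i → select (proj₂ (col v) ≟ i) 1)
      ≡⟨ cong₂ _+_ (∑-select-point m 1 t<m) (∑-select-point m 1 b<m) ⟩
    2 ∎
    where
    open ≡-Reasoning
    v = toℕ j
    t<m = proj₁ (valid v (toℕ<n j))
    b<m = proj₁ (proj₂ (valid v (toℕ<n j)))

  rowSum : ∀ i → sumℤ (λ j → val (array i j)) ≡ pos 0
  rowSum i = begin
    sumℤ (λ j → val (array i j))
      ≡⟨ sumℤ≡∑-∑ n (λ j → select (proj₁ (col j) ≟ toℕ i) (suc j))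
                    (λ j → select (proj₂ (col j) ≟ toℕ i) (suc j))
           (λ j → val-entry (proj₁ (col (toℕ j)) ≟ toℕ i) (proj₂ (col (toℕ j)) ≟ toℕ i) (toℕ j)
                            (top≢bot (toℕ j) (toℕ i) (toℕ<n j))) ⟩
    pos (weight (proj₁ ∘ col) 0 n (toℕ i) suc) ℤ.- pos (weight (proj₂ ∘ col) 0 n (toℕ i) suc)
      ≡⟨ cong (λ s → pos s ℤ.- pos (weight (proj₂ ∘ col) 0 n (toℕ i) suc)) (balanced (toℕ i) (toℕ<n i)) ⟩
    pos (weight (proj₂ ∘ col) 0 n (toℕ i) suc) ℤ.- pos (weight (proj₂ ∘ col) 0 n (toℕ i) suc)
      ≡⟨ ℤ.+-inverseʳ (pos (weight (proj₂ ∘ col) 0 n (toℕ i) suc)) ⟩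
    pos 0 ∎
    where open ≡-Reasoning

  colSum : ∀ j → sumℤ (λ i → val (array i j)) ≡ pos 0
  colSum j = begin
    sumℤ (λ i → val (array i j))
      ≡⟨ sumℤ≡∑-∑ m (λ i → select (proj₁ (col v) ≟ i) (suc v)) (λ i → select (proj₂ (col v) ≟ i) (suc v))
           (λ i → val-entry (proj₁ (col v) ≟ toℕ i) (proj₂ (col v) ≟ toℕ i) v
                            (top≢bot v (toℕ i) (toℕ<n j))) ⟩
    pos (∑ m (λ i → select (proj₁ (col v) ≟ i) (suc v)))
      ℤ.- pos (∑ m (λ i → select (proj₂ (col v) ≟ i) (suc v)))
      ≡⟨ cong₂ (λ s s' → pos s ℤ.- pos s') (∑-select-point m (suc v) t<m) (∑-select-point m (suc v) b<m) ⟩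
    pos (suc v) ℤ.- pos (suc v)
      ≡⟨ ℤ.+-inverseʳ (pos (suc v)) ⟩
    pos 0 ∎
    where
    open ≡-Reasoning
    v = toℕ j
    t<m = proj₁ (valid v (toℕ<n j))
    b<m = proj₁ (proj₂ (valid v (toℕ<n j)))

  pairing⇒SMR : SMR m n r 2
  pairing⇒SMR = array , record
    { rowCount   = rowCount
    ; colCount   = colCount
    ; entriesInX = λ i j x eq → let ∣x∣≡ = ∣entry∣ _ _ _ eq in subst (λ k → InX k x) (sym half-mr≡n)
                     (subst (1 ≤_) (sym ∣x∣≡) (s≤s z≤n) , subst (_≤ n) (sym ∣x∣≡) (toℕ<n j))
    ; eachOnce   = eachOnce
    ; rowSum     = rowSum
    ; colSum     = colSum
    }

infixr 5 _⟨_⟩_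
_⟨_⟩_ : {A : Set} → (ℕ → A) → ℕ → (ℕ → A) → ℕ → A
(f ⟨ n ⟩ g) j with j <? n
... | yes _ = f j
... | no _  = g (j ∸ n)

module _ {A : Set} (f : ℕ → A) (n : ℕ) (g : ℕ → A) where

  ⟨⟩-left : ∀ {j} → j < n → (f ⟨ n ⟩ g) j ≡ f j
  ⟨⟩-left {j} j<n with j <? n
  ... | yes _   = refl
  ... | no j≮n = ⊥-elim (j≮n j<n)

  ⟨⟩-right : ∀ t → (f ⟨ n ⟩ g) (n + t) ≡ g t
  ⟨⟩-right t with n + t <? n
  ... | yes n+t<n = ⊥-elim (m+n≮m n t n+t<n)
  ... | no _      = cong g (m+n∸m≡n n t)

  ⟨⟩-all : ∀ {p} (P : A → Set) → (∀ j → j < n → P (f j)) → (∀ t → t < p → P (g t)) →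
           ∀ j → j < n + p → P ((f ⟨ n ⟩ g) j)
  ⟨⟩-all P Pf Pg j j<n+p with j <? n
  ... | yes j<n = Pf j j<n
  ... | no j≮n  = Pg (j ∸ n) (+-cancelˡ-< n _ _ (subst (_< n + _) (sym (m+[n∸m]≡n (≮⇒≥ j≮n))) j<n+p))

  weight-⟨⟩ : ∀ (ρ : A → ℕ) o p i x →
    weight (ρ ∘ (f ⟨ n ⟩ g)) o (n + p) i x ≡ weight (ρ ∘ f) o n i x + weight (ρ ∘ g) (o + n) p i x
  weight-⟨⟩ ρ o p i x = trans (∑-split n p _) (cong₂ _+_
    (∑-cong n (λ t t<n → cong (λ a → select (ρ a ≟ i) (x (o + t))) (⟨⟩-left t<n)))
    (∑-cong p (λ t _ → cong₂ (λ a k → select (ρ a ≟ i) (x k)) (⟨⟩-right t) (sym (+-assoc o n t)))))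

weight-unique : ∀ row o n {i} x {t₀} → t₀ < n → row t₀ ≡ i → (∀ t → t < n → row t ≡ i → t ≡ t₀) →
                weight row o n i x ≡ x (o + t₀)
weight-unique row o n x = ∑-select-unique (λ t → row t ≟ _) (x ∘ (o +_)) n

weight-none : ∀ row o n {i} x → (∀ t → t < n → row t ≢ i) → weight row o n i x ≡ 0
weight-none row o n x = ∑-select-none (λ t → row t ≟ _) (x ∘ (o +_)) n

weight-shift : ∀ d o n {s} x → s < n → weight (d +_) o n (d + s) x ≡ x (o + s)
weight-shift d o n x s<n = weight-unique (d +_) o n x s<n refl (λ t _ → +-cancelˡ-≡ d t _)

weight-id-miss : ∀ o n {d} s x → n ≤ d → weight (λ t → t) o n (d + s) x ≡ 0
weight-id-miss o n s x n≤d = weight-none (λ t → t) o n x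
  (λ t t<n t≡d+s → <⇒≱ t<n (≤-trans n≤d (subst (_ ≤_) (sym t≡d+s) (m≤m+n _ s))))

weight-shift-miss : ∀ d o n {s} x → s < d → weight (d +_) o n s x ≡ 0
weight-shift-miss d o n x s<d = weight-none (d +_) o n x
  (λ t _ d+t≡s → <⇒≱ s<d (subst (d ≤_) d+t≡s (m≤m+n d t)))

occupancy-⟨⟩ : ∀ f n g p i → occupancy (f ⟨ n ⟩ g) (n + p) i ≡ occupancy f n i + occupancy g p i
occupancy-⟨⟩ f n g p i =
  trans (cong₂ _+_ (weight-⟨⟩ f n g proj₁ 0 p i (const 1)) (weight-⟨⟩ f n g proj₂ 0 p i (const 1)))
        (interchange (weight (proj₁ ∘ f) 0 n i (const 1)) _ _ _)

balanced-⟨⟩ : ∀ f n g o p i → Balanced f o n i → Balanced g (o + n) p i → Balanced (f ⟨ n ⟩ g) o (n + p) i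
balanced-⟨⟩ f n g o p i bf bg =
  trans (weight-⟨⟩ f n g proj₁ o p i suc) (trans (cong₂ _+_ bf bg) (sym (weight-⟨⟩ f n g proj₂ o p i suc)))

data Parity : ℕ → Set where
  even : ∀ q → Parity (q * 2)
  odd  : ∀ q → Parity (suc (q * 2))

parity : ∀ t → Parity t
parity zero          = even 0
parity (suc zero)    = odd 0
parity (suc (suc t)) with parity t
... | even q = even (suc q)
... | odd q  = odd (suc q)

n*2≡n+n : ∀ n → n * 2 ≡ n + n
n*2≡n+n = solve-∀

m*2<n+n⇒m<n : ∀ {q c} → q * 2 < c + c → q < c
m*2<n+n⇒m<n {q} {c} q1+q*2<c+c = *-cancelʳ-< 2 q c (subst (q * 2 <_) (sym (n*2≡n+n c)) q1+q*2<c+c)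

n∸1+m<n : ∀ {m n} → m < n → n ∸ suc m < n
n∸1+m<n {m} {suc n} (s≤s _) = s≤s (m∸n≤m n m)

n∸1+[n∸1+m]≡m : ∀ {m n} → m < n → n ∸ suc (n ∸ suc m) ≡ m
n∸1+[n∸1+m]≡m (s≤s m≤n) = m∸[m∸n]≡n m≤n

module Layout (c : ℕ) where

  data RowOf : ℕ → Set where
    upper : ∀ s → s < c → RowOf s
    lower : ∀ s → s < c → RowOf (c + s)

  rowOf : ∀ {i} → i < c + c → RowOf i
  rowOf {i} i<c+c with i <? c
  ... | yes i<c = upper i i<c
  ... | no i≮c  =
    subst RowOf c+[i∸c]≡i (lower (i ∸ c) (+-cancelˡ-< c _ _ (subst (_< c + c) (sym c+[i∸c]≡i) i<c+c)))
    where c+[i∸c]≡i = m+[n∸m]≡n (≮⇒≥ i≮c)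

  <⇒≢c+ : ∀ {t s} → t < c → t ≢ c + s
  <⇒≢c+ {s = s} t<c t≡c+s = <⇒≱ t<c (subst (c ≤_) (sym t≡c+s) (m≤m+n c s))

  mid : ℕ → ℕ
  mid zero          = c
  mid (suc zero)    = 0
  mid (suc (suc t)) = suc (mid t)

  mid-even : ∀ q → mid (q * 2) ≡ c + q
  mid-even zero    = sym (+-identityʳ c)
  mid-even (suc q) = trans (cong suc (mid-even q)) (sym (+-suc c q))

  mid-odd : ∀ q → mid (suc (q * 2)) ≡ q
  mid-odd zero    = refl
  mid-odd (suc q) = cong suc (mid-odd q)

  1+q*2<c+c : ∀ {q} → q < c → suc (q * 2) < c + c
  1+q*2<c+c {q} q<c = subst (suc (q * 2) <_) (n*2≡n+n c) (*-monoˡ-≤ 2 q<c)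

  up down start middle : ℕ → Column
  up     t = t , c + t
  down   t = c + t , t
  start  t = t , c + (c ∸ suc t)
  middle t = t , mid t

  quad : ℕ → Column
  quad = up ⟨ c ⟩ down ⟨ c ⟩ down ⟨ c ⟩ up

  head : ℕ → Column
  head = start ⟨ c ⟩ middle

  quadWidth headWidth : ℕ
  quadWidth = c + (c + (c + c))
  headWidth = c + (c + c)

  tail : ℕ → ℕ → Column
  tail zero    = quad   -- zero columns: never read
  tail (suc a) = quad ⟨ quadWidth ⟩ tail a

  layout : ℕ → ℕ → Column
  layout a = head ⟨ headWidth ⟩ tail a

  mid≡upper⇒odd : ∀ {s} → s < c → ∀ t → t < c + c → mid t ≡ s → t ≡ suc (s * 2)
  mid≡upper⇒odd s<c t t<c+c mid-t≡s with parity t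
  ... | even q = ⊥-elim (<⇒≢c+ s<c (sym (trans (sym (mid-even q)) mid-t≡s)))
  ... | odd q  = cong (λ q → suc (q * 2)) (trans (sym (mid-odd q)) mid-t≡s)

  mid≡lower⇒even : ∀ {u} → ∀ t → t < c + c → mid t ≡ c + u → t ≡ u * 2
  mid≡lower⇒even t t<c+c mid-t≡c+u with parity t
  ... | even q = cong (_* 2) (+-cancelˡ-≡ c q _ (trans (sym (mid-even q)) mid-t≡c+u))
  ... | odd q  =
    ⊥-elim (<⇒≢c+ (m*2<n+n⇒m<n (<-trans (n<1+n (q * 2)) t<c+c)) (trans (sym (mid-odd q)) mid-t≡c+u))

  middle-bot-upper : ∀ o {s} x → s < c → weight (proj₂ ∘ middle) o (c + c) s x ≡ x (o + suc (s * 2))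
  middle-bot-upper o {s} x s<c =
    weight-unique (proj₂ ∘ middle) o (c + c) x (1+q*2<c+c s<c) (mid-odd s) (mid≡upper⇒odd s<c)

  middle-bot-lower : ∀ o {u} x → u < c → weight (proj₂ ∘ middle) o (c + c) (c + u) x ≡ x (o + u * 2)
  middle-bot-lower o {u} x u<c =
    weight-unique (proj₂ ∘ middle) o (c + c) x (<-trans (n<1+n (u * 2)) (1+q*2<c+c u<c))
                  (mid-even u) mid≡lower⇒even

  start-bot-upper : ∀ o {s} x → s < c → weight (proj₂ ∘ start) o c s x ≡ 0
  start-bot-upper o x s<c = weight-none (proj₂ ∘ start) o c x (λ t _ eq → <⇒≢c+ s<c (sym eq))

  start-bot-lower : ∀ o {u} x → u < c → weight (proj₂ ∘ start) o c (c + u) x ≡ x (o + (c ∸ suc u))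
  start-bot-lower o x u<c =
    weight-unique (proj₂ ∘ start) o c x (n∸1+m<n u<c) (cong (c +_) (n∸1+[n∸1+m]≡m u<c))
    (λ t t<c eq → trans (sym (n∸1+[n∸1+m]≡m t<c)) (cong (λ k → c ∸ suc k) (+-cancelˡ-≡ c _ _ eq)))

  head-top-upper : ∀ o {s} x → s < c → weight (proj₁ ∘ head) o headWidth s x ≡ x (o + s) + x (o + c + s)
  head-top-upper o x s<c = trans (weight-⟨⟩ start c middle proj₁ o (c + c) _ x)
    (cong₂ _+_ (weight-shift 0 o c x s<c) (weight-shift 0 (o + c) (c + c) x (<-≤-trans s<c (m≤m+n c c))))

  head-bot-upper : ∀ o {s} x → s < c → weight (proj₂ ∘ head) o headWidth s x ≡ x (o + c + suc (s * 2))
  head-bot-upper o x s<c = trans (weight-⟨⟩ start c middle proj₂ o (c + c) _ x)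
    (cong₂ _+_ (start-bot-upper o x s<c) (middle-bot-upper (o + c) x s<c))

  head-top-lower : ∀ o {u} x → u < c → weight (proj₁ ∘ head) o headWidth (c + u) x ≡ x (o + c + (c + u))
  head-top-lower o {u} x u<c = trans (weight-⟨⟩ start c middle proj₁ o (c + c) _ x)
    (cong₂ _+_ (weight-id-miss o c u x ≤-refl) (weight-shift 0 (o + c) (c + c) x (+-monoʳ-< c u<c)))

  head-bot-lower : ∀ o {u} x → u < c →
                   weight (proj₂ ∘ head) o headWidth (c + u) x ≡ x (o + (c ∸ suc u)) + x (o + c + u * 2)
  head-bot-lower o x u<c = trans (weight-⟨⟩ start c middle proj₂ o (c + c) _ x)
    (cong₂ _+_ (start-bot-lower o x u<c) (middle-bot-lower (o + c) x u<c))

  head-occupancy : ∀ {i} → RowOf i → occupancy head headWidth i ≡ 3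
  head-occupancy (upper s s<c) = cong₂ _+_ (head-top-upper 0 (const 1) s<c) (head-bot-upper 0 (const 1) s<c)
  head-occupancy (lower u u<c) = cong₂ _+_ (head-top-lower 0 (const 1) u<c) (head-bot-lower 0 (const 1) u<c)

  -- Only at offset 0: every row has two cells of one sign and one of the other.
  head-balanced : ∀ {i} → RowOf i → Balanced head 0 headWidth i
  head-balanced (upper s s<c) =
    trans (head-top-upper 0 suc s<c) (trans (rowSums c s) (sym (head-bot-upper 0 suc s<c)))
    where
    rowSums : ∀ k s → suc s + suc (k + s) ≡ suc (k + suc (s * 2))
    rowSums = solve-∀
  head-balanced (lower u u<c) =
    trans (head-top-lower 0 suc u<c) (trans balance (sym (head-bot-lower 0 suc u<c)))
    where
    d = c ∸ suc u
    rowSums : ∀ u d → let k = suc u + d in suc (k + (k + u)) ≡ suc d + suc (k + u * 2)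
    rowSums = solve-∀
    balance : suc (c + (c + u)) ≡ suc d + suc (c + u * 2)
    balance = subst (λ k → suc (k + (k + u)) ≡ suc d + suc (k + u * 2)) (m+[n∸m]≡n u<c) (rowSums u d)

  quad-weight : ∀ (ρ : Column → ℕ) o i x →
    weight (ρ ∘ quad) o quadWidth i x ≡
    weight (ρ ∘ up) o c i x + (weight (ρ ∘ down) (o + c) c i x +
      (weight (ρ ∘ down) (o + c + c) c i x + weight (ρ ∘ up) (o + c + c + c) c i x))
  quad-weight ρ o i x = trans (weight-⟨⟩ up c _ ρ o _ i x) (cong (weight (ρ ∘ up) o c i x +_)
    (trans (weight-⟨⟩ down c _ ρ (o + c) _ i x) (cong (weight (ρ ∘ down) (o + c) c i x +_)
      (weight-⟨⟩ down c up ρ (o + c + c) c i x))))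

  module _ (o : ℕ) (x : ℕ → ℕ) {s : ℕ} (s<c : s < c) where

    quad-top-upper : weight (proj₁ ∘ quad) o quadWidth s x ≡ x (o + s) + x (o + c + c + c + s)
    quad-top-upper = trans (quad-weight proj₁ o s x)
      (cong₂ _+_ (weight-shift 0 o c x s<c) (cong₂ _+_ (weight-shift-miss c (o + c) c x s<c)
        (cong₂ _+_ (weight-shift-miss c (o + c + c) c x s<c) (weight-shift 0 (o + c + c + c) c x s<c))))

    quad-bot-upper : weight (proj₂ ∘ quad) o quadWidth s x ≡ x (o + c + s) + x (o + c + c + s)
    quad-bot-upper = trans (quad-weight proj₂ o s x)
      (cong₂ _+_ (weight-shift-miss c o c x s<c) (cong₂ _+_ (weight-shift 0 (o + c) c x s<c)
        (trans (cong₂ _+_ (weight-shift 0 (o + c + c) c x s<c) (weight-shift-miss c (o + c + c + c) c x s<c))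
               (+-identityʳ _))))

    quad-top-lower : weight (proj₁ ∘ quad) o quadWidth (c + s) x ≡ x (o + c + s) + x (o + c + c + s)
    quad-top-lower = trans (quad-weight proj₁ o (c + s) x)
      (cong₂ _+_ (weight-id-miss o c s x ≤-refl) (cong₂ _+_ (weight-shift c (o + c) c x s<c)
        (trans (cong₂ _+_ (weight-shift c (o + c + c) c x s<c) (weight-id-miss (o + c + c + c) c s x ≤-refl))
               (+-identityʳ _))))

    quad-bot-lower : weight (proj₂ ∘ quad) o quadWidth (c + s) x ≡ x (o + s) + x (o + c + c + c + s)
    quad-bot-lower = trans (quad-weight proj₂ o (c + s) x)
      (cong₂ _+_ (weight-shift c o c x s<c) (cong₂ _+_ (weight-id-miss (o + c) c s x ≤-refl)
        (cong₂ _+_ (weight-id-miss (o + c + c) c s x ≤-refl) (weight-shift c (o + c + c + c) c x s<c))))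

  quad-occupancy : ∀ {i} → RowOf i → occupancy quad quadWidth i ≡ 4
  quad-occupancy (upper s s<c) = cong₂ _+_ (quad-top-upper 0 (const 1) s<c) (quad-bot-upper 0 (const 1) s<c)
  quad-occupancy (lower s s<c) = cong₂ _+_ (quad-top-lower 0 (const 1) s<c) (quad-bot-lower 0 (const 1) s<c)

  outer≡inner : ∀ o k s → suc (o + s) + suc (o + k + k + k + s) ≡ suc (o + k + s) + suc (o + k + k + s)
  outer≡inner = solve-∀

  quad-balanced : ∀ {i} → RowOf i → ∀ o → Balanced quad o quadWidth i
  quad-balanced (upper s s<c) o =
    trans (quad-top-upper o suc s<c) (trans (outer≡inner o c s) (sym (quad-bot-upper o suc s<c)))
  quad-balanced (lower s s<c) o =
    trans (quad-top-lower o suc s<c) (trans (sym (outer≡inner o c s)) (sym (quad-bot-lower o suc s<c)))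

  tail-occupancy : ∀ {i} → RowOf i → ∀ a → occupancy (tail a) (a * quadWidth) i ≡ a * 4
  tail-occupancy row zero    = refl
  tail-occupancy row (suc a) = trans (occupancy-⟨⟩ quad quadWidth (tail a) (a * quadWidth) _)
                                     (cong₂ _+_ (quad-occupancy row) (tail-occupancy row a))

  tail-balanced : ∀ {i} → RowOf i → ∀ a o → Balanced (tail a) o (a * quadWidth) i
  tail-balanced row zero    o = refl
  tail-balanced row (suc a) o = balanced-⟨⟩ quad quadWidth (tail a) o (a * quadWidth) _
                                  (quad-balanced row o) (tail-balanced row a (o + quadWidth))

  up-valid : ∀ {t} → t < c → ValidColumn (c + c) (up t)
  up-valid t<c = <-≤-trans t<c (m≤m+n c c) , +-monoʳ-< c t<c , <⇒≢c+ t<c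

  down-valid : ∀ {t} → t < c → ValidColumn (c + c) (down t)
  down-valid t<c = let (t<m , c+t<m , t≢c+t) = up-valid t<c in c+t<m , t<m , t≢c+t ∘ sym

  start-valid : ∀ {t} → t < c → ValidColumn (c + c) (start t)
  start-valid t<c = <-≤-trans t<c (m≤m+n c c) , +-monoʳ-< c (n∸1+m<n t<c) , <⇒≢c+ t<c

  middle-valid : ∀ t → t < c + c → ValidColumn (c + c) (middle t)
  middle-valid t t<c+c with parity t
  ... | even q = t<c+c , subst (_< c + c) (sym (mid-even q)) (+-monoʳ-< c q<c) , q*2≢mid
    where
    q<c = m*2<n+n⇒m<n t<c+c
    q*2≢mid : q * 2 ≢ mid (q * 2)
    q*2≢mid eq = <-irrefl (+-cancelʳ-≡ q q c (trans (sym (n*2≡n+n q)) (trans eq (mid-even q)))) q<c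
  ... | odd q  = t<c+c , subst (_< c + c) (sym (mid-odd q)) q<c+c , 1+q*2≢mid
    where
    q<1+q*2 = s≤s (m≤m*n q 2)
    q<c+c = <-trans q<1+q*2 t<c+c
    1+q*2≢mid : suc (q * 2) ≢ mid (suc (q * 2))
    1+q*2≢mid eq = <⇒≢ q<1+q*2 (sym (trans eq (mid-odd q)))

  quad-valid : ∀ t → t < quadWidth → ValidColumn (c + c) (quad t)
  quad-valid = ⟨⟩-all up c _ (ValidColumn (c + c)) (λ _ → up-valid)
    (⟨⟩-all down c _ (ValidColumn (c + c)) (λ _ → down-valid)
      (⟨⟩-all down c up (ValidColumn (c + c)) (λ _ → down-valid) (λ _ → up-valid)))

  tail-valid : ∀ a t → t < a * quadWidth → ValidColumn (c + c) (tail a t)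
  tail-valid (suc a) = ⟨⟩-all quad quadWidth (tail a) (ValidColumn (c + c)) quad-valid (tail-valid a)

  head-valid : ∀ t → t < headWidth → ValidColumn (c + c) (head t)
  head-valid = ⟨⟩-all start c middle (ValidColumn (c + c)) (λ _ → start-valid) middle-valid

  layout-isPairing : ∀ a → IsPairing (c + c) (headWidth + a * quadWidth) (3 + a * 4) (layout a)
  layout-isPairing a = record
    { valid    = ⟨⟩-all head headWidth (tail a) (ValidColumn (c + c)) head-valid (tail-valid a)
    ; count    = λ i i<c+c → let row = rowOf i<c+c in
                 trans (occupancy-⟨⟩ head headWidth (tail a) _ i)
                       (cong₂ _+_ (head-occupancy row) (tail-occupancy row a))
    ; balanced = λ i i<c+c → let row = rowOf i<c+c in
                 balanced-⟨⟩ head headWidth (tail a) 0 _ i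
                   (head-balanced row) (tail-balanced row a headWidth)
    }

SMR-cong : ∀ {m m' n n' r r' s} → m ≡ m' → n ≡ n' → r ≡ r' → SMR m n r s → SMR m' n' r' s
SMR-cong refl refl refl smr = smr

SMR-2c : ∀ a c → SMR (2 * c) ((4 * a + 3) * c) (4 * a + 3) 2
SMR-2c a c = SMR-cong (+≡2* c) (width≡ a c) (rows≡ a)
                      (pairing⇒SMR (cellCount a c) (layout-isPairing a))
  where
  open Layout c
  +≡2* : ∀ c → c + c ≡ 2 * c
  +≡2* = solve-∀
  width≡ : ∀ a c → c + (c + c) + a * (c + (c + (c + c))) ≡ (4 * a + 3) * c
  width≡ = solve-∀
  rows≡ : ∀ a → 3 + a * 4 ≡ 4 * a + 3
  rows≡ = solve-∀
  cellCount : ∀ a c → (c + c) * (3 + a * 4) ≡ (c + (c + c) + a * (c + (c + (c + c)))) * 2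
  cellCount = solve-∀

lemma20 : (a b : ℕ) →
    SMR (4 * b + 2) ((4 * a + 3) * (2 * b + 1)) (4 * a + 3) 2
lemma20 a b = subst (λ m → SMR m ((4 * a + 3) * (2 * b + 1)) (4 * a + 3) 2) (rows b) (SMR-2c a (2 * b + 1))
  where
  rows : ∀ b → 2 * (2 * b + 1) ≡ 4 * b + 2
  rows = solve-∀
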